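{- Let $n,m\in\omega\cup\{\infty\}$. Every $C_{n,m}$-homogeneous linear ordering is $sp$-homogeneous.
   Context: For a linear ordering $L$ and $x\in L$, the number of successors of $x$ is the number of $y>x$ with only finitely many elements between $x$ and $y$, and the number of predecessors is defined dually. $S_i$ is the unary predicate "has exactly $i$ successors", $P_j$ the unary predicate "has exactly $j$ predecessors", and $Adj_k(x,y)$ the binary predicate "there are exactly $k$ elements strictly between $x$ and $y$". $L$ is $C_{n,m}$-homogeneous if its expansion by definitions to the language $(<,\{S_i\}_{i<n},\{P_j\}_{j<m},\{Adj_k\}_{k<n+m})$ is homogeneous (every isomorphism between finite substructures extends to an automorphism); here $i<\infty$ means $i\in\omega$. $s(x)$ is the immediate successor of $x$ if it exists and $x$ otherwise, $p(x)$ the immediate predecessor if it exists and $x$ otherwise, and $L$ is $sp$-homogeneous if $(L,<,s,p)$ is homogeneous (every isomorphism between finitely generated substructures extends to an automorphism). -}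

module Defs where

open import Data.Nat using (ℕ; _<_)
open import Data.Nat as ℕ using ()
open import Data.Fin using (Fin)
open import Data.List using (List; length)
open import Data.List.Membership.Propositional using (_∈_)
open import Data.List.Relation.Unary.Unique.Propositional using (Unique)
open import Data.Product using (Σ; ∃; _×_; _,_)
open import Data.Sum using (_⊎_)
open import Data.Unit using (⊤)
open import Function.Bundles using (_⇔_; _↔_; Inverse)
open import Relation.Binary.PropositionalEquality using (_≡_)
open import Relation.Binary.Structures using (IsStrictTotalOrder)
open import Relation.Nullary using (¬_)

data ℕ∞ : Set where
  fin : ℕ → ℕ∞
  ∞   : ℕ∞

_<∞_ : ℕ → ℕ∞ → Set
i <∞ fin n = i < n
i <∞ ∞     = ⊤

_+∞_ : ℕ∞ → ℕ∞ → ℕ∞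
fin n +∞ fin m = fin (n ℕ.+ m)
fin n +∞ ∞     = ∞
∞     +∞ _     = ∞

record LinearOrder : Set₁ where
  field
    Carrier : Set
    _<ₗ_    : Carrier → Carrier → Set
    isSTO   : IsStrictTotalOrder _≡_ _<ₗ_

module _ (L : LinearOrder) where
  open LinearOrder L renaming (Carrier to A; _<ₗ_ to _≺_)

  HasExactly : (A → Set) → ℕ → Set
  HasExactly P k = Σ (List A) λ xs →
    length xs ≡ k × Unique xs × (∀ z → (z ∈ xs) ⇔ P z)

  StrictlyBetween : A → A → A → Set
  StrictlyBetween x y z = (x ≺ z × z ≺ y) ⊎ (y ≺ z × z ≺ x)

  FinitelyBetween : A → A → Set
  FinitelyBetween x y = Σ (List A) λ xs → ∀ z → StrictlyBetween x y z → z ∈ xs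

  IsSuccessor : A → A → Set
  IsSuccessor x y = x ≺ y × FinitelyBetween x y

  IsPredecessor : A → A → Set
  IsPredecessor x y = y ≺ x × FinitelyBetween y x

  S : ℕ → A → Set
  S i x = HasExactly (IsSuccessor x) i

  P : ℕ → A → Set
  P j x = HasExactly (IsPredecessor x) j

  Adj : ℕ → A → A → Set
  Adj k x y = HasExactly (StrictlyBetween x y) k

  Automorphism : Set
  Automorphism = Σ (A ↔ A) λ σ →
    ∀ x y → (x ≺ y) ⇔ (Inverse.to σ x ≺ Inverse.to σ y)

  Extends : ∀ {k} → Automorphism → (Fin k → A) → (Fin k → A) → Set
  Extends (σ , _) a b = ∀ i → Inverse.to σ (a i) ≡ b i

  -- a i ↦ b i is an isomorphism of finite substructures of the expansion
  -- to (<, {S_i}_{i<n}, {P_j}_{j<m}, {Adj_k}_{k<n+m})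
  IsCPartialIso : ℕ∞ → ℕ∞ → ∀ {k} → (Fin k → A) → (Fin k → A) → Set
  IsCPartialIso n m a b =
    (∀ i j → (a i ≺ a j) ⇔ (b i ≺ b j)) ×
    (∀ l → l <∞ n → ∀ i → S l (a i) ⇔ S l (b i)) ×
    (∀ l → l <∞ m → ∀ i → P l (a i) ⇔ P l (b i)) ×
    (∀ l → l <∞ (n +∞ m) → ∀ i j → Adj l (a i) (a j) ⇔ Adj l (b i) (b j))

  CHomogeneous : ℕ∞ → ℕ∞ → Set
  CHomogeneous n m = ∀ k (a b : Fin k → A) → IsCPartialIso n m a b →
    Σ Automorphism λ σ → Extends σ a b

  ImmSucc : A → A → Set
  ImmSucc x y = x ≺ y × (∀ z → ¬ (x ≺ z × z ≺ y))

  -- graph of s:  s(x) = y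
  sGraph : A → A → Set
  sGraph x y = ImmSucc x y ⊎ (y ≡ x × ¬ (∃ λ z → ImmSucc x z))

  -- graph of p:  p(x) = y
  pGraph : A → A → Set
  pGraph x y = ImmSucc y x ⊎ (y ≡ x × ¬ (∃ λ z → ImmSucc z x))

  data Generated {k} (a : Fin k → A) : A → Set where
    gen  : ∀ i → Generated a (a i)
    gens : ∀ {x y} → Generated a x → sGraph x y → Generated a y
    genp : ∀ {x y} → Generated a x → pGraph x y → Generated a y

  IsSpIso : (A → Set) → (A → Set) → (A → A) → Set
  IsSpIso G H f =
    (∀ x → G x → H (f x)) ×
    (∀ y → H y → ∃ λ x → G x × f x ≡ y) ×
    (∀ x y → G x → G y → (x ≺ y) ⇔ (f x ≺ f y)) ×
    (∀ x y → G x → G y → sGraph x y ⇔ sGraph (f x) (f y)) ×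
    (∀ x y → G x → G y → pGraph x y ⇔ pGraph (f x) (f y))

  SpHomogeneous : Set
  SpHomogeneous = ∀ k l (a : Fin k → A) (b : Fin l → A) (f : A → A) →
    IsSpIso (Generated a) (Generated b) f →
    Σ Automorphism λ σ → ∀ x → Generated a x → Inverse.to (proj₁ σ) x ≡ f x
    where open Data.Product using (proj₁)

-- An sp-isomorphism f between finitely generated substructures restricts, on the
-- generators a, to an isomorphism of the expansion by S, P and Adj. Indeed y is a
-- successor of x exactly when y is reached from x by finitely many immediate
-- successor steps; the substructure generated by a is closed under s and p, and f
-- transports such chains in both directions, so f maps the successors,
-- predecessors and in-between points of generators bijectively onto those of
-- their images, and the counts agree. Any automorphism extending a ↦ f ∘ a
-- preserves s and p, hence agrees with f on everything generated by a.
module Submission where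

open import Defs
open import Level using (zero; _⊔_)
open import Axiom.ExcludedMiddle using (ExcludedMiddle)

open import Data.Empty using (⊥; ⊥-elim)
open import Data.Fin using (Fin)
open import Data.List using (List; []; _∷_)
open import Data.List.Membership.Propositional using (_∈_)
open import Data.List.Relation.Binary.Pointwise using (Pointwise; []; _∷_; Pointwise-length)
open import Data.List.Relation.Unary.All using (All; []; _∷_)
open import Data.List.Relation.Unary.AllPairs using ([]; _∷_)
open import Data.List.Relation.Unary.Any using (here; there)
open import Data.List.Relation.Unary.Unique.Propositional using (Unique)
open import Data.Product using (∃; _×_; _,_; proj₁; proj₂)
open import Data.Sum using (inj₁; inj₂)
open import Function using (_∘_; flip; id)
open import Function.Bundles using (_⇔_; mk⇔; Equivalence; Inverse)
open import Relation.Binary.Construct.Closure.ReflexiveTransitive using (Star; ε; _◅_; _◅◅_)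
import Relation.Binary.Construct.Closure.ReflexiveTransitive as Star
open import Relation.Binary.Core using (Rel)
open import Relation.Binary.Definitions using (tri<; tri≈; tri>)
open import Relation.Binary.PropositionalEquality using (_≡_; _≢_; refl; sym; trans; subst)
open import Relation.Binary.Structures using (IsStrictTotalOrder)
open import Relation.Nullary using (¬_; yes; no)
open import Relation.Nullary.Decidable using (_×-dec_)

open Equivalence using (to; from)

Simulates : ∀ {a r t} {A : Set a} → Rel A r → Rel A t → Set (a ⊔ r ⊔ t)
Simulates R T = ∀ {x x' y} → R x x' → T x y → ∃ λ y' → R y y' × T x' y'

star-simulation : ∀ {a r t} {A : Set a} {R : Rel A r} {T : Rel A t} →
                  Simulates R T → Simulates R (Star T)
star-simulation sim r ε = _ , r , ε
star-simulation sim r (t ◅ ts) with sim r t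
... | _ , r' , t' with star-simulation sim r' ts
... | y' , r'' , ts' = y' , r'' , t' ◅ ts'

⇔-sym : ∀ {P Q : Set} → P ⇔ Q → Q ⇔ P
⇔-sym e = mk⇔ (from e) (to e)

module _ (L : LinearOrder) where
  open LinearOrder L renaming (Carrier to A; _<ₗ_ to _≺_)
  open IsStrictTotalOrder isSTO renaming (trans to ≺-trans)

  _⋖_ : Rel A _
  _⋖_ = ImmSucc L

  _⋖*_ : Rel A _
  _⋖*_ = Star _⋖_

  ⋖-functional : ∀ {x y z} → x ⋖ y → x ⋖ z → y ≡ z
  ⋖-functional {y = y} {z} (x≺y , none-xy) (x≺z , none-xz) with compare y z
  ... | tri< y≺z _ _ = ⊥-elim (none-xz y (x≺y , y≺z))
  ... | tri≈ _ y≡z _ = y≡z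
  ... | tri> _ _ z≺y = ⊥-elim (none-xy z (x≺z , z≺y))

  ⋖-injective : ∀ {x y z} → x ⋖ z → y ⋖ z → x ≡ y
  ⋖-injective {x = x} {y} (x≺z , none-xz) (y≺z , none-yz) with compare x y
  ... | tri< x≺y _ _ = ⊥-elim (none-xz y (x≺y , y≺z))
  ... | tri≈ _ x≡y _ = x≡y
  ... | tri> _ _ y≺x = ⊥-elim (none-yz x (y≺x , x≺z))

  sGraph-functional : ∀ {x y z} → sGraph L x y → sGraph L x z → y ≡ z
  sGraph-functional (inj₁ x⋖y) (inj₁ x⋖z) = ⋖-functional x⋖y x⋖z
  sGraph-functional (inj₁ x⋖y) (inj₂ (_ , none)) = ⊥-elim (none (_ , x⋖y))
  sGraph-functional (inj₂ (_ , none)) (inj₁ x⋖z) = ⊥-elim (none (_ , x⋖z))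
  sGraph-functional (inj₂ (y≡x , _)) (inj₂ (z≡x , _)) = trans y≡x (sym z≡x)

  pGraph-functional : ∀ {x y z} → pGraph L x y → pGraph L x z → y ≡ z
  pGraph-functional (inj₁ y⋖x) (inj₁ z⋖x) = ⋖-injective y⋖x z⋖x
  pGraph-functional (inj₁ y⋖x) (inj₂ (_ , none)) = ⊥-elim (none (_ , y⋖x))
  pGraph-functional (inj₂ (_ , none)) (inj₁ z⋖x) = ⊥-elim (none (_ , z⋖x))
  pGraph-functional (inj₂ (y≡x , _)) (inj₂ (z≡x , _)) = trans y≡x (sym z≡x)

  IntervalIn : A → A → List A → Set
  IntervalIn x y zs = ∀ {z} → x ≺ z → z ≺ y → z ∈ zs

  intervalIn-drop : ∀ {x y w ws} → IntervalIn x y (w ∷ ws) → ¬ (x ≺ w × w ≺ y) →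
                    IntervalIn x y ws
  intervalIn-drop in-wws w∉ x≺z z≺y with in-wws x≺z z≺y
  ... | here refl = ⊥-elim (w∉ (x≺z , z≺y))
  ... | there z∈ws = z∈ws

  intervalIn⇒⋖* : ∀ {x y} zs → x ≺ y → IntervalIn x y zs → x ⋖* y
  intervalIn⇒⋖* [] x≺y in-[] = (x≺y , λ z (x≺z , z≺y) → case-∈[] (in-[] x≺z z≺y)) ◅ ε
    where
    case-∈[] : ∀ {z} → z ∈ [] → ⊥
    case-∈[] ()
  intervalIn⇒⋖* {x} {y} (w ∷ ws) x≺y in-wws with (x <? w) ×-dec (w <? y)
  ... | no w∉ = intervalIn⇒⋖* ws x≺y (intervalIn-drop in-wws w∉)
  ... | yes (x≺w , w≺y) =
    intervalIn⇒⋖* ws x≺w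
      (intervalIn-drop (λ x≺z z≺w → in-wws x≺z (≺-trans z≺w w≺y)) (irrefl refl ∘ proj₂))
    ◅◅
    intervalIn⇒⋖* ws w≺y
      (intervalIn-drop (λ w≺z z≺y → in-wws (≺-trans x≺w w≺z) z≺y) (irrefl refl ∘ proj₁))

  ⋖*⇒intervalIn : ∀ {x y} → x ⋖* y → ∃ (IntervalIn x y)
  ⋖*⇒intervalIn ε = [] , λ x≺z z≺x → ⊥-elim (asym x≺z z≺x)
  ⋖*⇒intervalIn ((_ , none-xw) ◅ w⋖*y) with ⋖*⇒intervalIn w⋖*y
  ... | zs , in-zs = _ ∷ zs , between
    where
    between : IntervalIn _ _ (_ ∷ zs)
    between {z} x≺z z≺y with compare z _
    ... | tri< z≺w _ _ = ⊥-elim (none-xw z (x≺z , z≺w))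
    ... | tri≈ _ z≡w _ = here z≡w
    ... | tri> _ _ w≺z = there (in-zs w≺z z≺y)

  finitelyBetween⇒⋖* : ∀ {x y} → x ≺ y → FinitelyBetween L x y → x ⋖* y
  finitelyBetween⇒⋖* x≺y (zs , in-zs) = intervalIn⇒⋖* zs x≺y (λ x≺z z≺y → in-zs _ (inj₁ (x≺z , z≺y)))

  ⋖*⇒finitelyBetween : ∀ {x y} → x ≺ y → x ⋖* y → FinitelyBetween L x y
  ⋖*⇒finitelyBetween x≺y x⋖*y with ⋖*⇒intervalIn x⋖*y
  ... | zs , in-zs = zs , λ where
    _ (inj₁ (x≺z , z≺y)) → in-zs x≺z z≺y
    _ (inj₂ (y≺z , z≺x)) → ⊥-elim (asym x≺y (≺-trans y≺z z≺x))

  finitelyBetween-refl : ∀ {x} → FinitelyBetween L x x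
  finitelyBetween-refl = [] , λ where
    _ (inj₁ (x≺z , z≺x)) → ⊥-elim (asym x≺z z≺x)
    _ (inj₂ (x≺z , z≺x)) → ⊥-elim (asym x≺z z≺x)

  finitelyBetween-sym : ∀ {x y} → FinitelyBetween L x y → FinitelyBetween L y x
  finitelyBetween-sym (zs , in-zs) = zs , λ where
    z (inj₁ between) → in-zs z (inj₂ between)
    z (inj₂ between) → in-zs z (inj₁ between)

  record SpPartialIso (R : Rel A zero) : Set where
    field
      preserves-< : ∀ {x x' y y'} → R x x' → R y y' → (x ≺ y) ⇔ (x' ≺ y')
      preserves-s : ∀ {x x' y y'} → R x x' → R y y' → sGraph L x y ⇔ sGraph L x' y'
      preserves-p : ∀ {x x' y y'} → R x x' → R y y' → pGraph L x y ⇔ pGraph L x' y'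
      dom-closed-s : ∀ {x x' y} → R x x' → sGraph L x y → ∃ (R y)
      dom-closed-p : ∀ {x x' y} → R x x' → pGraph L x y → ∃ (R y)
      cod-closed-s : ∀ {x x' y'} → R x x' → sGraph L x' y' → ∃ λ y → R y y'
      cod-closed-p : ∀ {x x' y'} → R x x' → pGraph L x' y' → ∃ λ y → R y y'

  converse : ∀ {R} → SpPartialIso R → SpPartialIso (flip R)
  converse iso = record
    { preserves-< = λ r r' → ⇔-sym (preserves-< r r')
    ; preserves-s = λ r r' → ⇔-sym (preserves-s r r')
    ; preserves-p = λ r r' → ⇔-sym (preserves-p r r')
    ; dom-closed-s = cod-closed-s
    ; dom-closed-p = cod-closed-p
    ; cod-closed-s = dom-closed-s
    ; cod-closed-p = dom-closed-p
    }
    where open SpPartialIso iso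

  module SpPartialIsoImages {R} (iso : SpPartialIso R) where
    open SpPartialIso iso

    functional : ∀ {x x' x''} → R x x' → R x x'' → x' ≡ x''
    functional {x' = x'} {x''} r r' with compare x' x''
    ... | tri< x'≺x'' _ _ = ⊥-elim (irrefl refl (from (preserves-< r r') x'≺x''))
    ... | tri≈ _ x'≡x'' _ = x'≡x''
    ... | tri> _ _ x''≺x' = ⊥-elim (irrefl refl (from (preserves-< r' r) x''≺x'))

    ⋖-simulation : Simulates R _⋖_
    ⋖-simulation r x⋖y with dom-closed-s r (inj₁ x⋖y)
    ... | y' , r' with to (preserves-s r r') (inj₁ x⋖y)
    ... | inj₁ x'⋖y' = y' , r' , x'⋖y'
    ... | inj₂ (refl , _) = ⊥-elim (irrefl refl (to (preserves-< r r') (proj₁ x⋖y)))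

    ⋗-simulation : Simulates R (flip _⋖_)
    ⋗-simulation r x⋖y with dom-closed-p r (inj₁ x⋖y)
    ... | x' , r' with to (preserves-p r r') (inj₁ x⋖y)
    ... | inj₁ x'⋖y' = x' , r' , x'⋖y'
    ... | inj₂ (refl , _) = ⊥-elim (irrefl refl (to (preserves-< r' r) (proj₁ x⋖y)))

    ⋖*-simulation : Simulates R _⋖*_
    ⋖*-simulation = star-simulation ⋖-simulation

    ⋗*-simulation : ∀ {x y y'} → R y y' → x ⋖* y → ∃ λ x' → R x x' × x' ⋖* y'
    ⋗*-simulation r x⋖*y with star-simulation ⋗-simulation r (Star.reverse id x⋖*y)
    ... | x' , r' , y'⋗*x' = x' , r' , Star.reverse id y'⋗*x'

    successor-image : ∀ {x x' z} → R x x' → IsSuccessor L x z →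
                      ∃ λ z' → R z z' × IsSuccessor L x' z'
    successor-image r (x≺z , between) with ⋖*-simulation r (finitelyBetween⇒⋖* x≺z between)
    ... | z' , r' , x'⋖*z' = z' , r' , x'≺z' , ⋖*⇒finitelyBetween x'≺z' x'⋖*z'
      where x'≺z' = to (preserves-< r r') x≺z

    predecessor-image : ∀ {x x' z} → R x x' → IsPredecessor L x z →
                        ∃ λ z' → R z z' × IsPredecessor L x' z'
    predecessor-image r (z≺x , between) with ⋗*-simulation r (finitelyBetween⇒⋖* z≺x between)
    ... | z' , r' , z'⋖*x' = z' , r' , z'≺x' , ⋖*⇒finitelyBetween z'≺x' z'⋖*x'
      where z'≺x' = to (preserves-< r' r) z≺x

    finitelyBetween-image : ∀ {x x' y y'} → R x x' → R y y' →
                            FinitelyBetween L x y → FinitelyBetween L x' y'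
    finitelyBetween-image {x} {y = y} r r' between with compare x y
    ... | tri< x≺y _ _ with ⋖*-simulation r (finitelyBetween⇒⋖* x≺y between)
    ...   | _ , r'' , x'⋖*y' rewrite functional r' r'' =
      ⋖*⇒finitelyBetween (to (preserves-< r r'') x≺y) x'⋖*y'
    finitelyBetween-image r r' between | tri≈ _ refl _ rewrite functional r r' = finitelyBetween-refl
    finitelyBetween-image r r' between | tri> _ _ y≺x
      with ⋖*-simulation r' (finitelyBetween⇒⋖* y≺x (finitelyBetween-sym between))
    ...   | _ , r'' , y'⋖*x' rewrite functional r r'' =
      finitelyBetween-sym (⋖*⇒finitelyBetween (to (preserves-< r' r'') y≺x) y'⋖*x')

    between-image : ∀ {x x' y y' z} → R x x' → R y y' → FinitelyBetween L x y →
                    StrictlyBetween L x y z → ∃ λ z' → R z z' × StrictlyBetween L x' y' z'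
    between-image r r' (zs , in-zs) (inj₁ (x≺z , z≺y))
      with ⋖*-simulation r (intervalIn⇒⋖* zs x≺z λ x≺w w≺z → in-zs _ (inj₁ (x≺w , ≺-trans w≺z z≺y)))
    ... | z' , r'' , _ = z' , r'' , inj₁ (to (preserves-< r r'') x≺z , to (preserves-< r'' r') z≺y)
    between-image r r' (zs , in-zs) (inj₂ (y≺z , z≺x))
      with ⋖*-simulation r' (intervalIn⇒⋖* zs y≺z λ y≺w w≺z → in-zs _ (inj₂ (y≺w , ≺-trans w≺z z≺x)))
    ... | z' , r'' , _ = z' , r'' , inj₂ (to (preserves-< r' r'') y≺z , to (preserves-< r'' r) z≺x)

  module Counting {R : Rel A zero}
                  (functional : ∀ {x x' x''} → R x x' → R x x'' → x' ≡ x'')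
                  (injective : ∀ {x y x'} → R x x' → R y x' → x ≡ y) where

    pointwise-image : ∀ zs → (∀ {z} → z ∈ zs → ∃ (R z)) → ∃ (Pointwise R zs)
    pointwise-image [] image = [] , []
    pointwise-image (z ∷ zs) image with image (here refl) | pointwise-image zs (image ∘ there)
    ... | z' , r | zs' , rs = z' ∷ zs' , r ∷ rs

    ∈-image : ∀ {zs zs' z z'} → Pointwise R zs zs' → z ∈ zs → R z z' → z' ∈ zs'
    ∈-image (r ∷ rs) (here refl) r' = here (functional r' r)
    ∈-image (r ∷ rs) (there z∈zs) r' = there (∈-image rs z∈zs r')

    ∈-preimage : ∀ {zs zs' z'} → Pointwise R zs zs' → z' ∈ zs' → ∃ λ z → z ∈ zs × R z z'
    ∈-preimage (r ∷ rs) (here refl) = _ , here refl , r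
    ∈-preimage (r ∷ rs) (there z'∈zs') with ∈-preimage rs z'∈zs'
    ... | z , z∈zs , r' = z , there z∈zs , r'

    ≢-image : ∀ {z z' zs zs'} → R z z' → Pointwise R zs zs' → All (z ≢_) zs → All (z' ≢_) zs'
    ≢-image r [] [] = []
    ≢-image r (r' ∷ rs) (z≢w ∷ z≢ws) = (λ { refl → z≢w (injective r r') }) ∷ ≢-image r rs z≢ws

    unique-image : ∀ {zs zs'} → Pointwise R zs zs' → Unique zs → Unique zs'
    unique-image [] [] = []
    unique-image (r ∷ rs) (z∉zs ∷ unique) = ≢-image r rs z∉zs ∷ unique-image rs unique

    hasExactly-image : ∀ {P Q : A → Set} {k} →
                       (∀ {z} → P z → ∃ λ z' → R z z' × Q z') →
                       (∀ {z'} → Q z' → ∃ λ z → R z z' × P z) →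
                       HasExactly L P k → HasExactly L Q k
    hasExactly-image {Q = Q} image preimage (zs , length≡k , unique , ∈⇔P)
      with pointwise-image zs (λ z∈zs → let z' , r , _ = image (to (∈⇔P _) z∈zs) in z' , r)
    ... | zs' , rs = zs' , trans (sym (Pointwise-length rs)) length≡k , unique-image rs unique ,
                     λ z' → mk⇔ (∈⇒Q z') (Q⇒∈ z')
      where
      ∈⇒Q : ∀ z' → z' ∈ zs' → Q z'
      ∈⇒Q z' z'∈zs' with ∈-preimage rs z'∈zs'
      ... | z , z∈zs , r with image (to (∈⇔P z) z∈zs)
      ... | _ , r' , q = subst Q (functional r' r) q

      Q⇒∈ : ∀ z' → Q z' → z' ∈ zs'
      Q⇒∈ z' q with preimage q
      ... | z , r , p = ∈-image rs (from (∈⇔P z) p) r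

  module _ {R} (iso : SpPartialIso R) where
    private
      module I = SpPartialIsoImages iso
      module I⁻¹ = SpPartialIsoImages (converse iso)
    open Counting I.functional I⁻¹.functional

    S-image : ∀ {x x' l} → R x x' → S L l x → S L l x'
    S-image r = hasExactly-image (I.successor-image r) (I⁻¹.successor-image r)

    P-image : ∀ {x x' l} → R x x' → P L l x → P L l x'
    P-image r = hasExactly-image (I.predecessor-image r) (I⁻¹.predecessor-image r)

    Adj-image : ∀ {x x' y y' l} → R x x' → R y y' → Adj L l x y → Adj L l x' y'
    Adj-image r r' adj@(zs , _ , _ , ∈⇔between) =
      hasExactly-image (I.between-image r r' between)
                       (I⁻¹.between-image r r' (I.finitelyBetween-image r r' between)) adj
      where
      between : FinitelyBetween L _ _
      between = zs , λ z → from (∈⇔between z)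

  spPartialIso⇒isCPartialIso : ∀ {R} → SpPartialIso R → ∀ n m {k} {a b : Fin k → A} →
                               (∀ i → R (a i) (b i)) → IsCPartialIso L n m a b
  spPartialIso⇒isCPartialIso iso n m r =
      (λ i j → SpPartialIso.preserves-< iso (r i) (r j))
    , (λ _ _ i → mk⇔ (S-image iso (r i)) (S-image (converse iso) (r i)))
    , (λ _ _ i → mk⇔ (P-image iso (r i)) (P-image (converse iso) (r i)))
    , (λ _ _ i j → mk⇔ (Adj-image iso (r i) (r j)) (Adj-image (converse iso) (r i) (r j)))

  module _ (σ : Automorphism L) where
    private
      τ τ⁻¹ : A → A
      τ = Inverse.to (proj₁ σ)
      τ⁻¹ = Inverse.from (proj₁ σ)

      τ∘τ⁻¹ : ∀ w → τ (τ⁻¹ w) ≡ w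
      τ∘τ⁻¹ = Inverse.strictlyInverseˡ (proj₁ σ)

      τ-≺ : ∀ x y → (x ≺ y) ⇔ (τ x ≺ τ y)
      τ-≺ = proj₂ σ

    ⋖-preserved : ∀ {x y} → x ⋖ y → τ x ⋖ τ y
    ⋖-preserved {x} {y} (x≺y , none) =
      to (τ-≺ x y) x≺y , λ w (τx≺w , w≺τy) →
        none (τ⁻¹ w) ( from (τ-≺ x (τ⁻¹ w)) (subst (τ x ≺_) (sym (τ∘τ⁻¹ w)) τx≺w)
                     , from (τ-≺ (τ⁻¹ w) y) (subst (_≺ τ y) (sym (τ∘τ⁻¹ w)) w≺τy))

    ⋖-reflected : ∀ {x y} → τ x ⋖ τ y → x ⋖ y
    ⋖-reflected {x} {y} (τx≺τy , none) =
      from (τ-≺ x y) τx≺τy , λ w (x≺w , w≺y) → none (τ w) (to (τ-≺ x w) x≺w , to (τ-≺ w y) w≺y)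

    sGraph-preserved : ∀ {x y} → sGraph L x y → sGraph L (τ x) (τ y)
    sGraph-preserved (inj₁ x⋖y) = inj₁ (⋖-preserved x⋖y)
    sGraph-preserved {x} (inj₂ (refl , none)) = inj₂ (refl , λ (w , τx⋖w) →
      none (τ⁻¹ w , ⋖-reflected (subst (τ x ⋖_) (sym (τ∘τ⁻¹ w)) τx⋖w)))

    pGraph-preserved : ∀ {x y} → pGraph L x y → pGraph L (τ x) (τ y)
    pGraph-preserved (inj₁ y⋖x) = inj₁ (⋖-preserved y⋖x)
    pGraph-preserved {x} (inj₂ (refl , none)) = inj₂ (refl , λ (w , w⋖τx) →
      none (τ⁻¹ w , ⋖-reflected (subst (_⋖ τ x) (sym (τ∘τ⁻¹ w)) w⋖τx)))

  module _ {k l} {a : Fin k → A} {b : Fin l → A} {f : A → A}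
           (f-iso : IsSpIso L (Generated L a) (Generated L b) f) where
    private
      G : A → Set
      G = Generated L a

      into : ∀ x → G x → Generated L b (f x)
      into = proj₁ f-iso

      onto : ∀ y → Generated L b y → ∃ λ x → G x × f x ≡ y
      onto = proj₁ (proj₂ f-iso)

      f-≺ : ∀ x y → G x → G y → (x ≺ y) ⇔ (f x ≺ f y)
      f-≺ = proj₁ (proj₂ (proj₂ f-iso))

      f-s : ∀ x y → G x → G y → sGraph L x y ⇔ sGraph L (f x) (f y)
      f-s = proj₁ (proj₂ (proj₂ (proj₂ f-iso)))

      f-p : ∀ x y → G x → G y → pGraph L x y ⇔ pGraph L (f x) (f y)
      f-p = proj₂ (proj₂ (proj₂ (proj₂ f-iso)))

    graphOn : Rel A zero
    graphOn x x' = G x × f x ≡ x'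

    graphOn-spPartialIso : SpPartialIso graphOn
    graphOn-spPartialIso = record
      { preserves-< = λ { (gx , refl) (gy , refl) → f-≺ _ _ gx gy }
      ; preserves-s = λ { (gx , refl) (gy , refl) → f-s _ _ gx gy }
      ; preserves-p = λ { (gx , refl) (gy , refl) → f-p _ _ gx gy }
      ; dom-closed-s = λ { (gx , refl) s → _ , gens gx s , refl }
      ; dom-closed-p = λ { (gx , refl) p → _ , genp gx p , refl }
      ; cod-closed-s = λ { (gx , refl) s → onto _ (gens (into _ gx) s) }
      ; cod-closed-p = λ { (gx , refl) p → onto _ (genp (into _ gx) p) }
      }

    automorphism-agrees : (σ : Automorphism L) → Extends L σ a (f ∘ a) →
                          ∀ x → G x → Inverse.to (proj₁ σ) x ≡ f x
    automorphism-agrees σ extends _ (gen i) = extends i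
    automorphism-agrees σ extends y (gens {x} gx s) =
      sGraph-functional
        (subst (λ w → sGraph L w (τ y)) (automorphism-agrees σ extends x gx) (sGraph-preserved σ s))
        (to (f-s x y gx (gens gx s)) s)
      where
      τ : A → A
      τ = Inverse.to (proj₁ σ)
    automorphism-agrees σ extends y (genp {x} gx p) =
      pGraph-functional
        (subst (λ w → pGraph L w (τ y)) (automorphism-agrees σ extends x gx) (pGraph-preserved σ p))
        (to (f-p x y gx (genp gx p)) p)
      where
      τ : A → A
      τ = Inverse.to (proj₁ σ)

mainTheorem5 : ExcludedMiddle zero → (n m : ℕ∞) (L : LinearOrder) →
    CHomogeneous L n m → SpHomogeneous L
mainTheorem5 _ n m L homogeneous k l a b f f-iso =
  let σ , extends = homogeneous k a (f ∘ a)
                      (spPartialIso⇒isCPartialIso L (graphOn-spPartialIso L f-iso) n m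
                                                   (λ i → gen i , refl))
  in σ , automorphism-agrees L f-iso σ extends
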